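{- Let $\mathcal{T}$ be a tiling by T-tetrominos of a rectangle of width $4$ (having $4$ rows, numbered $1,2,3,4$ from top to bottom, and $N$ columns, $N$ a multiple of 4), and let $l\ge 3$. Then $\mathcal{T}$ contains an arithmetic progression of tiles of length $l$ if and only if it contains an arithmetic progression of length $l$ consisting of tiles of type d1, where a tile of type d1 is one whose row of three squares lies in row $1$ and whose fourth square lies in row $2$ directly below the middle square of that row.
   Context: A T-tetromino is the polyomino consisting of four unit grid squares arranged as a row of three squares together with one square attached to the middle square of that row. A tiling of a rectangle is a covering of it by pairwise non-overlapping T-tetrominos on the unit grid. Two tiles are in the same orientation if one is a translate of the other. An arithmetic progression (AP) of tiles of length $l$ is a sequence $T_1,\dots,T_l$ of distinct tiles, all in the same orientation, such that the translation vector carrying $T_i$ to $T_{i+1}$ is the same for all $i$. -}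

module Defs where

open import Data.Nat using (ℕ; suc; _<_)
open import Data.Integer as ℤ using (ℤ; +_; _+_; _*_; _≤_)
import Data.Integer as Z
open import Data.Fin using (Fin)
open import Data.List using (List; _∷_; []; length; lookup)
open import Data.List.Membership.Propositional using (_∈_)
open import Data.Product using (Σ; ∃; _×_; _,_)
open import Relation.Binary.PropositionalEquality using (_≡_)
open import Data.Unit using (⊤)

-- Cells of the plane grid: (row , column), rows increase downwards.
Cell : Set
Cell = ℤ × ℤ

-- The four orientations of a T-tetromino, named by the direction in which
-- the fourth square ("stem") points away from the row of three.
data Orient : Set where
  down up left right : Orient

record Tile : Set where
  constructor tile
  field
    orient : Orient
    row    : ℤ
    col    : ℤ
open Tile public

-- Cells covered by a tile.  The anchor is the top-left cell of the
-- bounding box (2×3 or 3×2) of the tile.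
cells : Tile → List Cell
cells (tile down r c)  = (r , c) ∷ (r , c + + 1) ∷ (r , c + + 2) ∷ (r + + 1 , c + + 1) ∷ []
cells (tile up r c)    = (r + + 1 , c) ∷ (r + + 1 , c + + 1) ∷ (r + + 1 , c + + 2) ∷ (r , c + + 1) ∷ []
cells (tile right r c) = (r , c) ∷ (r + + 1 , c) ∷ (r + + 2 , c) ∷ (r + + 1 , c + + 1) ∷ []
cells (tile left r c)  = (r , c + + 1) ∷ (r + + 1 , c + + 1) ∷ (r + + 2 , c + + 1) ∷ (r + + 1 , c) ∷ []

translate : ℤ × ℤ → Tile → Tile
translate (dr , dc) (tile o r c) = tile o (r + dr) (c + dc)

-- The rectangle with 4 rows (0..3 = rows 1..4 of the paper) and N columns.
InRect : ℕ → Cell → Set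
InRect N (r , c) = (+ 0 ≤ r × r Z.< + 4) × (+ 0 ≤ c × c Z.< + N)

Tiling : ℕ → List Tile → Set
Tiling N ts =
  ((t : Tile) → t ∈ ts → (x : Cell) → x ∈ cells t → InRect N x) ×
  ((x : Cell) → InRect N x →
     (Σ (Fin (length ts)) λ i → x ∈ cells (lookup ts i)) ×
     ((i j : Fin (length ts)) → x ∈ cells (lookup ts i) → x ∈ cells (lookup ts j) → i ≡ j))

IsAPWith : (Tile → Set) → List Tile → ℕ → (ℕ → Tile) → Set
IsAPWith P ts l T =
  ((k : ℕ) → k < l → T k ∈ ts) ×
  ((k : ℕ) → k < l → P (T k)) ×
  ((j k : ℕ) → j < l → k < l → T j ≡ T k → j ≡ k) ×
  ((j k : ℕ) → j < l → k < l → orient (T j) ≡ orient (T k)) ×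
  (Σ (ℤ × ℤ) λ v → (k : ℕ) → suc k < l → T (suc k) ≡ translate v (T k))

AnyTile : Tile → Set
AnyTile _ = ⊤

-- Type d1: row of three in row 1 (index 0), stem in row 2 below its middle.
IsD1 : Tile → Set
IsD1 t = (orient t ≡ down) × (row t ≡ + 0)

HasAP : List Tile → ℕ → Set
HasAP ts l = Σ (ℕ → Tile) (IsAPWith AnyTile ts l)

HasD1AP : List Tile → ℕ → Set
HasD1AP ts l = Σ (ℕ → Tile) (IsAPWith IsD1 ts l)

-- Sweep the 4 × N rectangle from left to right in 4 × 4 blocks.  The tiles
-- straddling a block boundary form one of three profiles, and a forced case
-- analysis shows that each block is then filled in one of finitely many ways.
-- Hence every tile is the shift, by a multiple of 4 columns, of one of twelve
-- placements inside a block, and the same shift of the placement's partner,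
-- a d1 tile, is a tile as well.  In an AP the placements of three consecutive
-- members are "in AP modulo 4", which forces them to be equal.  So all members
-- of an AP share one placement, the common step is horizontal, and the
-- partners form an AP of d1 tiles.
module Submission where

open import Data.Nat as ℕ using (ℕ; zero; suc; _≤_; z≤n)
open import Data.Nat.Divisibility using (_∣_; divides)
open import Data.Nat.DivMod using (_%_; _/_; m≡m%n+[m/n]*n; m%n<n; [m+kn]%n≡m%n)
import Data.Nat.Properties as ℕP
import Data.Nat.Tactic.RingSolver as ℕ-Solver
open import Data.Integer as ℤ using (ℤ; +_; -[1+_]; +≤+; +<+)
import Data.Integer.Properties as ℤP
open import Data.Integer.Tactic.RingSolver using (solve-∀)
open import Data.Fin using (Fin; toℕ; #_)
open import Data.Fin.Properties using (toℕ<n)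
open import Data.List using (List; []; _∷_; map; filter; concatMap; cartesianProduct; upTo; lookup)
open import Data.List.Properties using (map-cong; map-∘)
open import Data.List.Relation.Unary.All as All using (All; []; _∷_)
open import Data.List.Relation.Unary.Any as Any using (Any; here; there)
open import Data.List.Relation.Unary.Any.Properties using (lookup-index)
open import Data.List.Relation.Binary.Subset.Propositional using (_⊆_)
open import Data.List.Membership.Propositional using (_∈_; find; lose)
open import Data.List.Membership.Propositional.Properties
  using (∈-map⁺; ∈-map⁻; ∈-filter⁺; ∈-concatMap⁺; ∈-cartesianProduct⁺; ∈-upTo⁺; ∈-lookup)
open import Data.Product using (∃-syntax; _×_; _,_; proj₁; proj₂)
open import Data.Product.Properties using (≡-dec)
open import Data.Sum using (_⊎_; inj₁; inj₂)
open import Data.Unit using (tt)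
open import Data.Empty using (⊥-elim)
open import Function using (_∘_)
open import Relation.Nullary using (Dec; yes; no; ¬_; ¬?)
open import Relation.Nullary.Decidable using (True; toWitness; from-yes; map′; _×-dec_; _⊎-dec_; _→-dec_)
open import Relation.Binary.Definitions using (DecidableEquality)
open import Relation.Binary.PropositionalEquality
open import Algebra.Properties.CommutativeSemigroup ℤP.+-commutativeSemigroup using (xy∙z≈xz∙y)

open import Defs

_≟ᵒ_ : DecidableEquality Orient
down  ≟ᵒ down  = yes refl
down  ≟ᵒ up    = no λ ()
down  ≟ᵒ left  = no λ ()
down  ≟ᵒ right = no λ ()
up    ≟ᵒ down  = no λ ()
up    ≟ᵒ up    = yes refl
up    ≟ᵒ left  = no λ ()
up    ≟ᵒ right = no λ ()
left  ≟ᵒ down  = no λ ()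
left  ≟ᵒ up    = no λ ()
left  ≟ᵒ left  = yes refl
left  ≟ᵒ right = no λ ()
right ≟ᵒ down  = no λ ()
right ≟ᵒ up    = no λ ()
right ≟ᵒ left  = no λ ()
right ≟ᵒ right = yes refl

_≟ᵗ_ : DecidableEquality Tile
tile o r c ≟ᵗ tile o′ r′ c′ =
  map′ (λ { (refl , refl , refl) → refl }) (λ { refl → refl , refl , refl })
       (o ≟ᵒ o′ ×-dec r ℤ.≟ r′ ×-dec c ℤ.≟ c′)

_≟ᶜ_ : DecidableEquality Cell
_≟ᶜ_ = ≡-dec ℤ._≟_ ℤ._≟_

open import Data.List.Membership.DecPropositional _≟ᵗ_ using (_∈?_)
open import Data.List.Membership.DecPropositional _≟ᶜ_ using () renaming (_∈?_ to _∈ᶜ?_)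

[i+j]-j≡i : ∀ i j → (i ℤ.+ j) ℤ.- j ≡ i
[i+j]-j≡i = solve-∀

[i-j]+j≡i : ∀ i j → (i ℤ.- j) ℤ.+ j ≡ i
[i-j]+j≡i = solve-∀

+-cancelʳ-≡ : ∀ {i j} k → i ℤ.+ k ≡ j ℤ.+ k → i ≡ j
+-cancelʳ-≡ {i} {j} k eq = trans (sym ([i+j]-j≡i i k)) (trans (cong (ℤ._- k) eq) ([i+j]-j≡i j k))

_⊕_ : Cell → ℤ × ℤ → Cell
(r , c) ⊕ (dr , dc) = (r ℤ.+ dr , c ℤ.+ dc)

_⊖_ : Cell → ℤ × ℤ → Cell
(r , c) ⊖ (dr , dc) = (r ℤ.- dr , c ℤ.- dc)

[x⊕d]⊖d≡x : ∀ x d → (x ⊕ d) ⊖ d ≡ x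
[x⊕d]⊖d≡x (r , c) (dr , dc) = cong₂ _,_ ([i+j]-j≡i r dr) ([i+j]-j≡i c dc)

shape : Orient → List (ℤ × ℤ)
shape down  = (+ 0 , + 0) ∷ (+ 0 , + 1) ∷ (+ 0 , + 2) ∷ (+ 1 , + 1) ∷ []
shape up    = (+ 1 , + 0) ∷ (+ 1 , + 1) ∷ (+ 1 , + 2) ∷ (+ 0 , + 1) ∷ []
shape right = (+ 0 , + 0) ∷ (+ 1 , + 0) ∷ (+ 2 , + 0) ∷ (+ 1 , + 1) ∷ []
shape left  = (+ 0 , + 1) ∷ (+ 1 , + 1) ∷ (+ 2 , + 1) ∷ (+ 1 , + 0) ∷ []

tileAt : Orient → Cell → Tile
tileAt o (r , c) = tile o r c

cells-shape : ∀ o x → cells (tileAt o x) ≡ map (x ⊕_) (shape o)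
cells-shape down  (r , c) rewrite ℤP.+-identityʳ r | ℤP.+-identityʳ c = refl
cells-shape up    (r , c) rewrite ℤP.+-identityʳ r | ℤP.+-identityʳ c = refl
cells-shape right (r , c) rewrite ℤP.+-identityʳ r | ℤP.+-identityʳ c = refl
cells-shape left  (r , c) rewrite ℤP.+-identityʳ r | ℤP.+-identityʳ c = refl

shift : ℤ → Tile → Tile
shift d (tile o r c) = tile o r (c ℤ.+ d)

shiftCell : ℤ → Cell → Cell
shiftCell d (r , c) = (r , c ℤ.+ d)

cells-shift : ∀ d t → cells (shift d t) ≡ map (shiftCell d) (cells t)
cells-shift d (tile o r c) = begin
  cells (tileAt o (r , c ℤ.+ d))                   ≡⟨ cells-shape o (r , c ℤ.+ d) ⟩
  map ((r , c ℤ.+ d) ⊕_) (shape o)                 ≡⟨ map-cong (λ δ → cong (r ℤ.+ proj₁ δ ,_) (xy∙z≈xz∙y c d (proj₂ δ)))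
                                                                (shape o) ⟩
  map (shiftCell d ∘ ((r , c) ⊕_)) (shape o)       ≡⟨ map-∘ (shape o) ⟩
  map (shiftCell d) (map ((r , c) ⊕_) (shape o))   ≡⟨ cong (map (shiftCell d)) (cells-shape o (r , c)) ⟨
  map (shiftCell d) (cells (tile o r c))           ∎
  where open ≡-Reasoning

∈-cells-shift⁺ : ∀ d {x t} → x ∈ cells t → shiftCell d x ∈ cells (shift d t)
∈-cells-shift⁺ d {t = t} x∈ = subst (_ ∈_) (sym (cells-shift d t)) (∈-map⁺ (shiftCell d) x∈)

shift-shift : ∀ d e t → shift d (shift e t) ≡ shift (e ℤ.+ d) t
shift-shift d e (tile o r c) = cong (tile o r) (ℤP.+-assoc c e d)

shift-inverseˡ : ∀ d t → shift (ℤ.- d) (shift d t) ≡ t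
shift-inverseˡ d (tile o r c) = cong (tile o r) ([i+j]-j≡i c d)

shift-inverseʳ : ∀ d t → shift d (shift (ℤ.- d) t) ≡ t
shift-inverseʳ d (tile o r c) = cong (tile o r) ([i-j]+j≡i c d)

shift-injective : ∀ d {s t} → shift d s ≡ shift d t → s ≡ t
shift-injective d {s} {t} eq =
  trans (sym (shift-inverseˡ d s)) (trans (cong (shift (ℤ.- d)) eq) (shift-inverseˡ d t))

shiftCell-inverseˡ : ∀ d x → shiftCell (ℤ.- d) (shiftCell d x) ≡ x
shiftCell-inverseˡ d (r , c) = cong (r ,_) ([i+j]-j≡i c d)

anchor : ∀ t → ∃[ x ] x ∈ cells t × proj₂ x ≡ col t
anchor (tile down  r c) = _ , here refl , refl
anchor (tile up    r c) = _ , here refl , refl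
anchor (tile right r c) = _ , here refl , refl
anchor (tile left  r c) = _ , there (there (there (here refl))) , refl

orientations : List Orient
orientations = down ∷ up ∷ right ∷ left ∷ []

∈-orientations : ∀ o → o ∈ orientations
∈-orientations down  = here refl
∈-orientations up    = there (here refl)
∈-orientations right = there (there (here refl))
∈-orientations left  = there (there (there (here refl)))

coveringTiles : Cell → Orient → List Tile
coveringTiles x o = map (λ δ → tileAt o (x ⊖ δ)) (shape o)

candidates : Cell → List Tile
candidates x = concatMap (coveringTiles x) orientations

candidates-complete : ∀ {x t} → x ∈ cells t → t ∈ candidates x
candidates-complete {x} {tile o r c} x∈ with ∈-map⁻ ((r , c) ⊕_) (subst (x ∈_) (cells-shape o (r , c)) x∈)
... | δ , δ∈ , refl =
  ∈-concatMap⁺ (coveringTiles x) (lose (∈-orientations o)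
    (subst (_∈ coveringTiles x o) (cong (tileAt o) ([x⊕d]⊖d≡x (r , c) δ))
           (∈-map⁺ (λ δ → tileAt o (x ⊖ δ)) δ∈)))

-- Placements of a tile inside a block

record Placement : Set where
  constructor placement
  field
    orientation : Orient
    height      : ℤ
    offset      : ℕ
    partnerCol  : ℕ
open Placement

_≟ᵖ_ : DecidableEquality Placement
placement o h e q ≟ᵖ placement o′ h′ e′ q′ =
  map′ (λ { (refl , refl , refl , refl) → refl }) (λ { refl → refl , refl , refl , refl })
       (o ≟ᵒ o′ ×-dec h ℤ.≟ h′ ×-dec e ℕ.≟ e′ ×-dec q ℕ.≟ q′)

localTile : Placement → Tile
localTile p = tile (orientation p) (height p) (+ offset p)

partner : Placement → Tile
partner p = tile down (+ 0) (+ partnerCol p)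

inBlock : ℕ → Placement → Tile
inBlock j p = shift (+ (j ℕ.* 4)) (localTile p)

-- The block analysis below shows that every tile sits in its block as one of
-- these placements, and that the d1 tile at column partnerCol of the same
-- block is then a tile too.
placements : List Placement
placements =
  placement down  (+ 0) 0 0 ∷ placement up    (+ 2) 1 0 ∷ placement right (+ 1) 0 0 ∷
  placement up    (+ 0) 2 0 ∷ placement down  (+ 2) 3 0 ∷ placement left  (+ 0) 2 0 ∷
  placement down  (+ 0) 1 1 ∷ placement up    (+ 2) 0 1 ∷ placement right (+ 0) 0 1 ∷
  placement down  (+ 2) 2 1 ∷ placement up    (+ 0) 3 1 ∷ placement left  (+ 1) 2 1 ∷ []

InAPMod4 : Placement → Placement → Placement → Set
InAPMod4 p q r =
  orientation p ≡ orientation q × orientation q ≡ orientation r ×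
  height p ℤ.+ height r ≡ height q ℤ.+ height q ×
  (offset p ℕ.+ offset r) % 4 ≡ (offset q ℕ.+ offset q) % 4

inAPMod4? : ∀ p q r → Dec (InAPMod4 p q r)
inAPMod4? p q r =
  orientation p ≟ᵒ orientation q ×-dec orientation q ≟ᵒ orientation r ×-dec
  height p ℤ.+ height r ℤ.≟ height q ℤ.+ height q ×-dec
  (offset p ℕ.+ offset r) % 4 ℕ.≟ (offset q ℕ.+ offset q) % 4

placements-rigid :
  All (λ p → All (λ q → All (λ r → InAPMod4 p q r → p ≡ q × q ≡ r) placements) placements) placements
placements-rigid = from-yes
  (All.all? (λ p → All.all? (λ q → All.all? (λ r →
     inAPMod4? p q r →-dec (p ≟ᵖ q ×-dec q ≟ᵖ r)) placements) placements) placements)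

-- Filling one 4 × 4 block

InRows : Cell → Set
InRows (r , _) = + 0 ℤ.≤ r × r ℤ.< + 4

inRows? : ∀ x → Dec (InRows x)
inRows? (r , _) = + 0 ℤ.≤? r ×-dec r ℤ.<? + 4

Disjoint : Tile → Tile → Set
Disjoint s t = ¬ Any (_∈ cells t) (cells s)

disjoint? : ∀ s t → Dec (Disjoint s t)
disjoint? s t = ¬? (Any.any? (_∈ᶜ? cells t) (cells s))

-- A tile that may cover a cell of the block, given the tiles E crossing the
-- left boundary and the tiles K already known to lie in the tiling.
Compatible : List Tile → List Tile → Tile → Set
Compatible E K t =
  All InRows (cells t) ×
  (Any (λ y → proj₂ y ℤ.< + 0) (cells t) → t ∈ E) ×
  All (λ k → t ≡ k ⊎ Disjoint t k) K

compatible? : ∀ E K t → Dec (Compatible E K t)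
compatible? E K t =
  All.all? inRows? (cells t) ×-dec
  (Any.any? (λ y → proj₂ y ℤ.<? + 0) (cells t) →-dec t ∈? E) ×-dec
  All.all? (λ k → t ≟ᵗ k ⊎-dec disjoint? t k) K

digits : List ℤ
digits = map +_ (upTo 4)

blockCells : List Cell
blockCells = cartesianProduct digits digits

digit : ∀ {z} → + 0 ℤ.≤ z → z ℤ.< + 4 → z ∈ digits
digit {+ n} _ n<4 = ∈-map⁺ +_ (∈-upTo⁺ (ℤP.drop‿+<+ n<4))

blockCell : ∀ {y} → InRows y → + 0 ℤ.≤ proj₂ y → proj₂ y ℤ.< + 4 → y ∈ blockCells
blockCell (0≤r , r<4) 0≤c c<4 = ∈-cartesianProduct⁺ (digit 0≤r r<4) (digit 0≤c c<4)

Covers : List Tile → Set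
Covers K = All (λ y → Any (λ k → y ∈ cells k) K) blockCells

covers? : ∀ K → Dec (Covers K)
covers? K = All.all? (λ y → Any.any? (λ k → y ∈ᶜ? cells k) K) blockCells

Located : List Tile → Set
Located K = All (λ k → col k ℤ.< + 0 ⊎ Any (λ p → k ≡ localTile p × partner p ∈ K) placements) K

located? : ∀ K → Dec (Located K)
located? K =
  All.all? (λ k → col k ℤ.<? + 0 ⊎-dec Any.any? (λ p → k ≟ᵗ localTile p ×-dec partner p ∈? K) placements) K

Exits : List Tile → List Tile → Set
Exits K E′ = All (λ k → Any (λ y → + 4 ℤ.≤ proj₂ y) (cells k) → shift (ℤ.- + 4) k ∈ E′) K

exits? : ∀ K E′ → Dec (Exits K E′)
exits? K E′ =
  All.all? (λ k → Any.any? (λ y → + 4 ℤ.≤? proj₂ y) (cells k) →-dec shift (ℤ.- + 4) k ∈? E′) K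

data Boundary : Set where
  flat jagged₁ jagged₂ : Boundary

-- The tiles of the previous block that protrude into the next one, in the
-- coordinates of the next block.
entering : Boundary → List Tile
entering flat    = []
entering jagged₁ = tile up (+ 0) -[1+ 1 ] ∷ tile down (+ 2) -[1+ 0 ] ∷ []
entering jagged₂ = tile down (+ 2) -[1+ 1 ] ∷ tile up (+ 0) -[1+ 0 ] ∷ []

cellAt : Fin 4 → Fin 4 → Cell
cellAt r c = (+ toℕ r , + toℕ c)

-- A case analysis filling a block whose left boundary is crossed by E, with
-- the tiles K found so far: 'branch r c' splits on the tile covering the cell
-- (r , c), one subtree per compatible candidate; 'close' ends a branch with a
-- covered block and the boundary profile it leaves for the next block.
data Search (E : List Tile) : List Tile → Set where
  branch : ∀ {K} (r c : Fin 4) →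
           All (λ t → Search E (t ∷ K)) (filter (compatible? E K) (candidates (cellAt r c))) →
           Search E K
  close  : ∀ {K} (next : Boundary) →
           {True (covers? K)} → {True (located? K)} → {True (exits? K (entering next))} →
           {True (All.all? (λ t → shift (+ 4) t ∈? K) (entering next))} →
           Search E K

infix 6 _↦_

_↦_ : ∀ {E K} t → Search E (t ∷ K) → Search E (t ∷ K)
_ ↦ s = s

search : ∀ β → Search (entering β) (entering β)
search flat = branch (# 0) (# 0)
  ( tile down (+ 0) (+ 0) ↦ branch (# 1) (# 0)
    ( tile right (+ 1) (+ 0) ↦ branch (# 3) (# 1)
      ( tile up (+ 2) (+ 1) ↦ branch (# 1) (# 2)
        ( tile down (+ 1) (+ 2) ↦ branch (# 0) (# 3) []
        ∷ tile up (+ 0) (+ 2) ↦ branch (# 2) (# 3) (tile down (+ 2) (+ 3) ↦ close jagged₁ ∷ [])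
        ∷ tile left (+ 0) (+ 2) ↦ close flat
        ∷ [])
      ∷ [])
    ∷ [])
  ∷ tile right (+ 0) (+ 0) ↦ branch (# 3) (# 0)
    ( tile up (+ 2) (+ 0) ↦ branch (# 0) (# 1)
      ( tile down (+ 0) (+ 1) ↦ branch (# 2) (# 2)
        ( tile down (+ 2) (+ 2) ↦ branch (# 1) (# 3) (tile up (+ 0) (+ 3) ↦ close jagged₂ ∷ [])
        ∷ tile up (+ 1) (+ 2) ↦ branch (# 3) (# 3) []
        ∷ tile left (+ 1) (+ 2) ↦ close flat
        ∷ [])
      ∷ [])
    ∷ [])
  ∷ [])
search jagged₁ = branch (# 0) (# 0)
  ( tile down (+ 0) (+ 0) ↦ branch (# 3) (# 1)
    ( tile up (+ 2) (+ 1) ↦ branch (# 1) (# 2)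
      ( tile down (+ 1) (+ 2) ↦ branch (# 0) (# 3) []
      ∷ tile up (+ 0) (+ 2) ↦ branch (# 2) (# 3) (tile down (+ 2) (+ 3) ↦ close jagged₁ ∷ [])
      ∷ tile left (+ 0) (+ 2) ↦ close flat
      ∷ [])
    ∷ [])
  ∷ [])
search jagged₂ = branch (# 3) (# 0)
  ( tile up (+ 2) (+ 0) ↦ branch (# 0) (# 1)
    ( tile down (+ 0) (+ 1) ↦ branch (# 2) (# 2)
      ( tile down (+ 2) (+ 2) ↦ branch (# 1) (# 3) (tile up (+ 0) (+ 3) ↦ close jagged₂ ∷ [])
      ∷ tile up (+ 1) (+ 2) ↦ branch (# 3) (# 3) []
      ∷ tile left (+ 1) (+ 2) ↦ close flat
      ∷ [])
    ∷ [])
  ∷ [])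

*-<-∣⇒suc*-≤ : ∀ {d n k} → d ∣ n → k ℕ.* d ℕ.< n → suc k ℕ.* d ≤ n
*-<-∣⇒suc*-≤ {d} {k = k} (divides q refl) kd<qd = ℕP.*-monoˡ-≤ d (ℕP.*-cancelʳ-< d k q kd<qd)

record Classified (ts : List Tile) (t : Tile) : Set where
  field
    block     : ℕ
    place     : Placement
    listed    : place ∈ placements
    position  : t ≡ inBlock block place
    partnerIn : shift (+ (block ℕ.* 4)) (partner place) ∈ ts
open Classified

module _ {N : ℕ} {ts : List Tile} (tiling : Tiling N ts) where

  inside : ∀ {t x} → t ∈ ts → x ∈ cells t → InRect N x
  inside t∈ x∈ = proj₁ tiling _ t∈ _ x∈

  covered : ∀ x → InRect N x → ∃[ t ] t ∈ ts × x ∈ cells t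
  covered x x-in = let i , x∈ = proj₁ (proj₂ tiling x x-in) in lookup ts i , ∈-lookup i , x∈

  overlap⇒≡ : ∀ {s t x} → s ∈ ts → t ∈ ts → x ∈ cells s → x ∈ cells t → s ≡ t
  overlap⇒≡ {s} {t} {x} s∈ t∈ x∈s x∈t = trans s≡ (trans (cong (lookup ts) i≡j) (sym t≡))
    where
    s≡ : s ≡ lookup ts (Any.index s∈)
    s≡ = lookup-index s∈
    t≡ : t ≡ lookup ts (Any.index t∈)
    t≡ = lookup-index t∈
    i≡j : Any.index s∈ ≡ Any.index t∈
    i≡j = proj₂ (proj₂ tiling x (inside s∈ x∈s)) (Any.index s∈) (Any.index t∈)
            (subst (λ u → x ∈ cells u) s≡ x∈s) (subst (λ u → x ∈ cells u) t≡ x∈t)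

  col-bounds : ∀ {t} → t ∈ ts → + 0 ℤ.≤ col t × col t ℤ.< + N
  col-bounds {t} t∈ with anchor t
  ... | x , x∈t , refl = proj₂ (inside t∈ x∈t)

  -- Tiles in the coordinates of the block starting at column b.
  Occurs : ℕ → Tile → Set
  Occurs b t = shift (+ b) t ∈ ts

  occurs-inRows : ∀ {b t y} → Occurs b t → y ∈ cells t → InRows y
  occurs-inRows {b} ot y∈ = proj₁ (inside ot (∈-cells-shift⁺ (+ b) y∈))

  occurs-covered : ∀ b x → InRect N (shiftCell (+ b) x) → ∃[ t ] Occurs b t × x ∈ cells t
  occurs-covered b x x-in with covered _ x-in
  ... | T , T∈ , x∈T =
    shift (ℤ.- + b) T , subst (_∈ ts) (sym (shift-inverseʳ (+ b) T)) T∈ ,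
    subst (_∈ cells _) (shiftCell-inverseˡ (+ b) x) (∈-cells-shift⁺ (ℤ.- + b) x∈T)

  occurs-overlap⇒≡ : ∀ {b s t x} → Occurs b s → Occurs b t → x ∈ cells s → x ∈ cells t → s ≡ t
  occurs-overlap⇒≡ {b} os ot x∈s x∈t =
    shift-injective (+ b) (overlap⇒≡ os ot (∈-cells-shift⁺ (+ b) x∈s) (∈-cells-shift⁺ (+ b) x∈t))

  equal-or-disjoint : ∀ {b t k} → Occurs b t → Occurs b k → t ≡ k ⊎ Disjoint t k
  equal-or-disjoint {t = t} {k} ot ok with Any.any? (_∈ᶜ? cells k) (cells t)
  ... | no  t∩k=∅ = inj₂ t∩k=∅
  ... | yes t∩k   = let y , y∈t , y∈k = find t∩k in inj₁ (occurs-overlap⇒≡ ot ok y∈t y∈k)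

  CrossersIn : ℕ → List Tile → Set
  CrossersIn b E = ∀ {t y z} → Occurs b t → y ∈ cells t → z ∈ cells t →
                   proj₂ y ℤ.< + 0 → + 0 ℤ.≤ proj₂ z → t ∈ E

  crossers-initial : CrossersIn 0 []
  crossers-initial {y = y} ot y∈ _ y<0 _ =
    ⊥-elim (ℤP.<-irrefl refl (ℤP.<-≤-trans y<0 (subst (+ 0 ℤ.≤_) (ℤP.+-identityʳ (proj₂ y)) 0≤y+0)))
    where
    0≤y+0 : + 0 ℤ.≤ proj₂ y ℤ.+ + 0
    0≤y+0 = proj₁ (proj₂ (inside ot (∈-cells-shift⁺ (+ 0) y∈)))

  occurs⇒compatible : ∀ {b E K t x} → CrossersIn b E → All (Occurs b) K →
                      Occurs b t → x ∈ cells t → + 0 ℤ.≤ proj₂ x → Compatible E K t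
  occurs⇒compatible crossers occ ot x∈t 0≤x =
    All.tabulate (occurs-inRows ot) ,
    (λ neg → let y , y∈t , y<0 = find neg in crossers ot y∈t x∈t y<0 0≤x) ,
    All.map (equal-or-disjoint ot) occ

  force : ∀ {b E K} → CrossersIn b E → All (Occurs b) K →
          ∀ x → + 0 ℤ.≤ proj₂ x → InRect N (shiftCell (+ b) x) →
          ∃[ t ] Occurs b t × t ∈ filter (compatible? E K) (candidates x)
  force {b} {E} {K} crossers occ x 0≤x x-in with occurs-covered b x x-in
  ... | t , ot , x∈t =
    t , ot , ∈-filter⁺ (compatible? E K) (candidates-complete x∈t) (occurs⇒compatible crossers occ ot x∈t 0≤x)

  -- A tile crossing the next boundary either crosses the current one too, so
  -- is listed in E ⊆ K, or covers a cell of the current block, so is in K.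
  crossers-next : ∀ {b E E′ K} → CrossersIn b E → E ⊆ K → All (Occurs b) K → Covers K → Exits K E′ →
                  CrossersIn (4 ℕ.+ b) E′
  crossers-next {b} {K = K} crossers E⊆K occ covers exits {t} {y} {z} ot y∈t z∈t y<0 0≤z =
    subst (_∈ _) (shift-inverseˡ (+ 4) t) (All.lookup exits t₄∈K (lose z₄∈ 4≤z₄))
    where
    o₄ : Occurs b (shift (+ 4) t)
    o₄ = subst (_∈ ts) (sym (shift-shift (+ b) (+ 4) t)) ot
    y₄∈ : shiftCell (+ 4) y ∈ cells (shift (+ 4) t)
    y₄∈ = ∈-cells-shift⁺ (+ 4) y∈t
    z₄∈ : shiftCell (+ 4) z ∈ cells (shift (+ 4) t)
    z₄∈ = ∈-cells-shift⁺ (+ 4) z∈t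
    4≤z₄ : + 4 ℤ.≤ proj₂ z ℤ.+ + 4
    4≤z₄ = ℤP.+-monoˡ-≤ (+ 4) 0≤z
    t₄∈K : shift (+ 4) t ∈ K
    t₄∈K with proj₂ y ℤ.+ + 4 ℤ.<? + 0
    ... | yes y₄<0 = E⊆K (crossers o₄ y₄∈ z₄∈ y₄<0 (ℤP.≤-trans (+≤+ z≤n) 4≤z₄))
    ... | no  y₄≮0
      with find (All.lookup covers (blockCell (occurs-inRows o₄ y₄∈) (ℤP.≮⇒≥ y₄≮0) (ℤP.+-monoˡ-< (+ 4) y<0)))
    ...   | k , k∈K , y₄∈k = subst (_∈ K) (sym (occurs-overlap⇒≡ o₄ (All.lookup occ k∈K) y₄∈ y₄∈k)) k∈K

  record Frontier (b : ℕ) : Set where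
    field
      boundary : Boundary
      entered  : All (Occurs b) (entering boundary)
      crossers : CrossersIn b (entering boundary)

  record Block (b : ℕ) : Set where
    field
      tiles    : List Tile
      occur    : All (Occurs b) tiles
      covering : Covers tiles
      located  : Located tiles
      next     : Frontier (4 ℕ.+ b)

  cellAt-inRect : ∀ {b} → 4 ℕ.+ b ≤ N → ∀ r c → InRect N (shiftCell (+ b) (cellAt r c))
  cellAt-inRect {b} 4+b≤N r c =
    (+≤+ z≤n , +<+ (toℕ<n r)) , (+≤+ z≤n , +<+ (ℕP.<-≤-trans (ℕP.+-monoˡ-< b (toℕ<n c)) 4+b≤N))

  mutual
    runSearch : ∀ {b E K} → CrossersIn b E → 4 ℕ.+ b ≤ N → E ⊆ K → All (Occurs b) K →
                Search E K → Block b
    runSearch crossers 4+b≤N E⊆K occ (branch r c children)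
      with force crossers occ (cellAt r c) (+≤+ z≤n) (cellAt-inRect 4+b≤N r c)
    ... | t , ot , t∈ = runChild crossers 4+b≤N E⊆K occ children t∈ ot
    runSearch {b} {K = K} crossers 4+b≤N E⊆K occ (close next {cov} {loc} {ex} {ent}) = record
      { tiles    = K
      ; occur    = occ
      ; covering = toWitness cov
      ; located  = toWitness loc
      ; next     = record
        { boundary = next
        ; entered  = All.map (λ {t} t₄∈K → subst (_∈ ts) (shift-shift (+ b) (+ 4) t) (All.lookup occ t₄∈K))
                             (toWitness ent)
        ; crossers = crossers-next crossers E⊆K occ (toWitness cov) (toWitness ex)
        }
      }

    runChild : ∀ {b E K xs t} → CrossersIn b E → 4 ℕ.+ b ≤ N → E ⊆ K → All (Occurs b) K →
               All (λ t → Search E (t ∷ K)) xs → t ∈ xs → Occurs b t → Block b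
    runChild crossers 4+b≤N E⊆K occ (s ∷ _) (here refl) ot = runSearch crossers 4+b≤N (there ∘ E⊆K) (ot ∷ occ) s
    runChild crossers 4+b≤N E⊆K occ (_ ∷ ss) (there t∈) ot = runChild crossers 4+b≤N E⊆K occ ss t∈ ot

  fillBlock : ∀ {b} → Frontier b → 4 ℕ.+ b ≤ N → Block b
  fillBlock F 4+b≤N =
    runSearch (Frontier.crossers F) 4+b≤N (λ t∈ → t∈) (Frontier.entered F) (search (Frontier.boundary F))

  frontierAt : ∀ j → j ℕ.* 4 ≤ N → Frontier (j ℕ.* 4)
  blockAt    : ∀ j → suc j ℕ.* 4 ≤ N → Block (j ℕ.* 4)

  frontierAt zero    _  = record { boundary = flat ; entered = [] ; crossers = crossers-initial }
  frontierAt (suc j) le = Block.next (blockAt j le)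

  blockAt j le = fillBlock (frontierAt j (ℕP.≤-trans (ℕP.m≤n+m (j ℕ.* 4) 4) le)) le

  block-located : ∀ {b t} → Block b → Occurs b t → + 0 ℤ.≤ col t → col t ℤ.< + 4 →
                  ∃[ p ] p ∈ placements × t ≡ localTile p × Occurs b (partner p)
  block-located {t = t} B ot 0≤c c<4 with anchor t
  ... | x , x∈t , refl
    with find (All.lookup (Block.covering B) (blockCell (occurs-inRows ot x∈t) 0≤c c<4))
  ... | k , k∈K , x∈k
    with occurs-overlap⇒≡ ot (All.lookup (Block.occur B) k∈K) x∈t x∈k | All.lookup (Block.located B) k∈K
  ... | refl | inj₁ c<0 = ⊥-elim (ℤP.<-irrefl refl (ℤP.<-≤-trans c<0 0≤c))
  ... | refl | inj₂ at-p with find at-p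
  ...   | p , p∈ , t≡ , partner∈ = p , p∈ , t≡ , All.lookup (Block.occur B) partner∈

  classify : 4 ∣ N → ∀ {t} → t ∈ ts → Classified ts t
  classify 4∣N {tile o r -[1+ n ]} t∈ with proj₁ (col-bounds t∈)
  ... | ()
  classify 4∣N {tile o r (+ n)} t∈ =
    let p , p∈ , t′≡ , partner∈ =
          block-located (blockAt j (*-<-∣⇒suc*-≤ {k = j} 4∣N j*4<N)) ot′ (+≤+ z≤n) (+<+ (m%n<n n 4))
    in record
      { block     = j
      ; place     = p
      ; listed    = p∈
      ; position  = trans (cong (λ m → tile o r (+ m)) n≡) (cong (shift (+ (j ℕ.* 4))) t′≡)
      ; partnerIn = partner∈
      }
    where
    j : ℕ
    j = n / 4
    n≡ : n ≡ n % 4 ℕ.+ j ℕ.* 4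
    n≡ = m≡m%n+[m/n]*n n 4
    ot′ : Occurs (j ℕ.* 4) (tile o r (+ (n % 4)))
    ot′ = subst (λ m → tile o r (+ m) ∈ ts) n≡ t∈
    j*4<N : j ℕ.* 4 ℕ.< N
    j*4<N = ℕP.≤-<-trans (ℕP.m≤n+m (j ℕ.* 4) (n % 4))
                         (subst (ℕ._< N) n≡ (ℤP.drop‿+<+ (proj₂ (col-bounds t∈))))

-- Arithmetic progressions

midpoint : ∀ x d → x ℤ.+ ((x ℤ.+ d) ℤ.+ d) ≡ (x ℤ.+ d) ℤ.+ (x ℤ.+ d)
midpoint = solve-∀

translate-midpoint : ∀ {s t u} v → t ≡ translate v s → u ≡ translate v t →
                     orient s ≡ orient t × orient t ≡ orient u ×
                     row s ℤ.+ row u ≡ row t ℤ.+ row t × col s ℤ.+ col u ≡ col t ℤ.+ col t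
translate-midpoint {tile o r c} (dr , dc) refl refl = refl , refl , midpoint r dr , midpoint c dc

sum%4-blocks : ∀ a b c d i j k l →
               (a ℕ.+ i ℕ.* 4) ℕ.+ (b ℕ.+ j ℕ.* 4) ≡ (c ℕ.+ k ℕ.* 4) ℕ.+ (d ℕ.+ l ℕ.* 4) →
               (a ℕ.+ b) % 4 ≡ (c ℕ.+ d) % 4
sum%4-blocks a b c d i j k l eq = begin
  (a ℕ.+ b) % 4                               ≡⟨ [m+kn]%n≡m%n (a ℕ.+ b) (i ℕ.+ j) 4 ⟨
  ((a ℕ.+ b) ℕ.+ (i ℕ.+ j) ℕ.* 4) % 4         ≡⟨ cong (_% 4) (regroup a b i j) ⟩
  ((a ℕ.+ i ℕ.* 4) ℕ.+ (b ℕ.+ j ℕ.* 4)) % 4   ≡⟨ cong (_% 4) eq ⟩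
  ((c ℕ.+ k ℕ.* 4) ℕ.+ (d ℕ.+ l ℕ.* 4)) % 4   ≡⟨ cong (_% 4) (regroup c d k l) ⟨
  ((c ℕ.+ d) ℕ.+ (k ℕ.+ l) ℕ.* 4) % 4         ≡⟨ [m+kn]%n≡m%n (c ℕ.+ d) (k ℕ.+ l) 4 ⟩
  (c ℕ.+ d) % 4                               ∎
  where
  open ≡-Reasoning
  regroup : ∀ a b i j → (a ℕ.+ b) ℕ.+ (i ℕ.+ j) ℕ.* 4 ≡ (a ℕ.+ i ℕ.* 4) ℕ.+ (b ℕ.+ j ℕ.* 4)
  regroup = ℕ-Solver.solve-∀

placements-in-AP-equal : ∀ {p q r i j k} v → p ∈ placements → q ∈ placements → r ∈ placements →
                         inBlock j q ≡ translate v (inBlock i p) → inBlock k r ≡ translate v (inBlock j q) →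
                         p ≡ q × q ≡ r
placements-in-AP-equal {p} {q} {r} {i} {j} {k} v p∈ q∈ r∈ step₁ step₂
  with translate-midpoint {inBlock i p} {inBlock j q} {inBlock k r} v step₁ step₂
... | o₁ , o₂ , heights , cols =
  All.lookup (All.lookup (All.lookup placements-rigid p∈) q∈) r∈
    (o₁ , o₂ , heights , sum%4-blocks (offset p) (offset r) (offset q) (offset q) i k j j (ℤP.+-injective cols))

consecutive-equal⇒constant : ∀ {A : Set} {l} (f : ∀ k → k ℕ.< l → A) →
                             (∀ k (p : k ℕ.< l) (q : suc k ℕ.< l) → f k p ≡ f (suc k) q) →
                             ∀ k (p : k ℕ.< l) (q : 0 ℕ.< l) → f k p ≡ f 0 q
consecutive-equal⇒constant f consecutive zero    p q = cong (f 0) (ℕP.<-irrelevant p q)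
consecutive-equal⇒constant f consecutive (suc k) p q =
  trans (sym (consecutive k (ℕP.<⇒≤ p) p)) (consecutive-equal⇒constant f consecutive k (ℕP.<⇒≤ p) q)

[e+m]+[q-e]≡q+m : ∀ e m q → (e ℤ.+ m) ℤ.+ (q ℤ.- e) ≡ q ℤ.+ m
[e+m]+[q-e]≡q+m = solve-∀

-- The partners are described through the columns of the Tₖ, so that they form
-- a sequence indexed by all of ℕ.
partners-form-AP : ∀ {ts l T} p (j : ∀ k → k ℕ.< l → ℕ) → IsAPWith AnyTile ts l T →
                   (∀ k (k<l : k ℕ.< l) → T k ≡ inBlock (j k k<l) p) →
                   (∀ k (k<l : k ℕ.< l) → shift (+ (j k k<l ℕ.* 4)) (partner p) ∈ ts) →
                   HasD1AP ts l
partners-form-AP {ts} {l} {T} p j (_ , _ , distinct , _ , (_ , dc) , step) position partnerIn =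
  D , member , (λ _ _ → refl , refl) , distinctD , (λ _ _ _ _ → refl) , (+ 0 , dc) , stepD
  where
  δ : ℤ
  δ = + partnerCol p ℤ.- + offset p
  D : ℕ → Tile
  D k = tile down (+ 0) (col (T k) ℤ.+ δ)
  member : ∀ k → k ℕ.< l → D k ∈ ts
  member k k<l = subst (λ c → tile down (+ 0) c ∈ ts)
    (sym (trans (cong (λ t → col t ℤ.+ δ) (position k k<l))
                ([e+m]+[q-e]≡q+m (+ offset p) (+ (j k k<l ℕ.* 4)) (+ partnerCol p))))
    (partnerIn k k<l)
  distinctD : ∀ a b → a ℕ.< l → b ℕ.< l → D a ≡ D b → a ≡ b
  distinctD a b a<l b<l Da≡Db = distinct a b a<l b<l (begin
    T a                                        ≡⟨ position a a<l ⟩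
    inBlock (j a a<l) p                        ≡⟨ cong (tile (orientation p) (height p)) cols ⟩
    inBlock (j b b<l) p                        ≡⟨ position b b<l ⟨
    T b                                        ∎)
    where
    open ≡-Reasoning
    cols : col (inBlock (j a a<l) p) ≡ col (inBlock (j b b<l) p)
    cols = trans (cong col (sym (position a a<l)))
                 (trans (+-cancelʳ-≡ δ (cong col Da≡Db)) (cong col (position b b<l)))
  stepD : ∀ k → suc k ℕ.< l → D (suc k) ≡ translate (+ 0 , dc) (D k)
  stepD k k+1<l = cong (tile down (+ 0))
    (trans (cong (λ t → col t ℤ.+ δ) (step k k+1<l)) (xy∙z≈xz∙y (col (T k)) dc δ))

module _ {ts : List Tile} (classified : ∀ {t} → t ∈ ts → Classified ts t) where

  AP⇒d1-AP : ∀ {l} → 3 ℕ.≤ l → HasAP ts l → HasD1AP ts l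
  AP⇒d1-AP {l} 3≤l (T , AP@(member , _ , _ , _ , v , step)) =
    partners-form-AP (placeOf 0 0<l) blockOf AP
      (λ k k<l → trans (position (cls k k<l)) (cong (inBlock (blockOf k k<l)) (constant k k<l 0<l)))
      (λ k k<l → subst (λ p → shift (+ (blockOf k k<l ℕ.* 4)) (partner p) ∈ ts)
                        (constant k k<l 0<l) (partnerIn (cls k k<l)))
    where
    0<l : 0 ℕ.< l
    0<l = ℕP.<-≤-trans (ℕ.s≤s z≤n) 3≤l
    cls : ∀ k → k ℕ.< l → Classified ts (T k)
    cls k k<l = classified (member k k<l)
    placeOf : ∀ k → k ℕ.< l → Placement
    placeOf k k<l = place (cls k k<l)
    blockOf : ∀ k → k ℕ.< l → ℕ
    blockOf k k<l = block (cls k k<l)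
    moves : ∀ k (p : k ℕ.< l) (q : suc k ℕ.< l) →
            inBlock (blockOf (suc k) q) (placeOf (suc k) q) ≡ translate v (inBlock (blockOf k p) (placeOf k p))
    moves k p q = trans (sym (position (cls (suc k) q))) (trans (step k q) (cong (translate v) (position (cls k p))))
    triple : ∀ k (p : k ℕ.< l) (q : suc k ℕ.< l) (r : suc (suc k) ℕ.< l) →
             placeOf k p ≡ placeOf (suc k) q × placeOf (suc k) q ≡ placeOf (suc (suc k)) r
    triple k p q r =
      placements-in-AP-equal {i = blockOf k p} {j = blockOf (suc k) q} {k = blockOf (suc (suc k)) r} v
        (listed (cls k p)) (listed (cls (suc k) q)) (listed (cls (suc (suc k)) r)) (moves k p q) (moves (suc k) q r)
    consecutive : ∀ k (p : k ℕ.< l) (q : suc k ℕ.< l) → placeOf k p ≡ placeOf (suc k) q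
    consecutive zero    p q = proj₁ (triple 0 p q 3≤l)
    consecutive (suc k) p q = proj₂ (triple k (ℕP.<⇒≤ p) p q)
    constant : ∀ k (p : k ℕ.< l) (q : 0 ℕ.< l) → placeOf k p ≡ placeOf 0 q
    constant = consecutive-equal⇒constant placeOf consecutive

lemma2 : (N : ℕ) → 4 ∣ N → (ts : List Tile) → Tiling N ts →
         (l : ℕ) → 3 ≤ l →
         (HasAP ts l → HasD1AP ts l) × (HasD1AP ts l → HasAP ts l)
lemma2 N 4∣N ts tiling l 3≤l = AP⇒d1-AP (classify tiling 4∣N) 3≤l , d1-AP⇒AP
  where
  d1-AP⇒AP : HasD1AP ts l → HasAP ts l
  d1-AP⇒AP (T , member , _ , rest) = T , member , (λ _ _ → tt) , rest
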